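{- Let $h>0$ and $\alpha>0$ be integers and $\lambda\vdash h+\alpha$. Define $\varphi_{\lambda,h,\alpha}$ on $\operatorname{SYT}_{h,\alpha}(\lambda)$ as follows. If $T\in\operatorname{SYT}_{h,\alpha-1}(\lambda)$, set $\varphi_{\lambda,h,\alpha}(T):=T$. Otherwise let $q:=\max\{1\leq i\leq h: R_{T}(i+\alpha)\leq R_{T}(\alpha)\}$, and let $\varphi_{\lambda,h,\alpha}(T)$ be the tableau of shape $\lambda$ in which, for $1\le m\le h+\alpha$, the number $m$ is placed in the box \[v_{\varphi_{\lambda,h,\alpha}(T)}(m)=\begin{cases} v_{T}(m) & 1\leq m\leq\alpha-1,\\ v_{T}(m+1) & \alpha\leq m\leq q-2+\alpha\ \text{or}\ q+\alpha\leq m\leq h-1+\alpha,\\ v_{T}(\alpha) & m=q-1+\alpha,\\ v_{T}(q+\alpha) & m=h+\alpha.\end{cases}\] Then $\varphi_{\lambda,h,\alpha}(T)\in\operatorname{SYT}_{h,\alpha-1}(\lambda)$ for every $T\in\operatorname{SYT}_{h,\alpha}(\lambda)$.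
   Context: For a partition $\lambda\vdash k$, its diagram has boxes $(i,j)$, $1\le i\le\ell(\lambda)$, $1\le j\le\lambda_i$ (row $i$ from the top). $\operatorname{SYT}(\lambda)$ is the set of standard Young tableaux of shape $\lambda$ (bijective fillings with $1,\ldots,k$ increasing along rows and down columns). For a tableau $T$ and $1\le m\le k$, $R_T(m)$ and $C_T(m)$ are the row and column of the box containing $m$, and $v_T(m)=(R_T(m),C_T(m))$. For $0\le h\le k$ and $0\le\alpha\le k-h$, $\operatorname{SYT}_{h,\alpha}(\lambda)$ is the set of $T\in\operatorname{SYT}(\lambda)$ with $R_T(i+1+\alpha)>R_T(i+\alpha)$ for all $1\le i<h$. -}

module Defs where

open import Data.Nat using (ℕ; zero; suc; _+_; _∸_; _≤_; _<_; _≤ᵇ_; _<ᵇ_; _≡ᵇ_)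
open import Data.Bool using (Bool; true; false; if_then_else_; _∧_; _∨_)
open import Data.List using (List; []; _∷_; length)
open import Data.Nat.ListAction using (sum)
open import Data.List.Relation.Unary.All using (All)
open import Data.List.Relation.Unary.Linked using (Linked)
open import Data.Product using (_×_; _,_; proj₁; proj₂; ∃-syntax)
open import Relation.Binary.PropositionalEquality using (_≡_)
open import Relation.Nullary using (Dec; yes; no)
open import Data.Nat using (_≥_)

IsPartition : List ℕ → ℕ → Set
IsPartition λ′ k = Linked _≥_ λ′ × All (λ x → 1 ≤ x) λ′ × sum λ′ ≡ k

-- Length of row i (rows numbered from 1; row 0 and rows beyond ℓ(λ) have length 0).
rowLen : List ℕ → ℕ → ℕ
rowLen [] _ = 0
rowLen (x ∷ xs) zero = 0
rowLen (x ∷ xs) (suc zero) = x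
rowLen (x ∷ xs) (suc (suc i)) = rowLen xs (suc i)

Box : Set
Box = ℕ × ℕ

InDiagram : List ℕ → Box → Set
InDiagram λ′ (i , j) = 1 ≤ i × i ≤ length λ′ × 1 ≤ j × j ≤ rowLen λ′ i

-- A filling is described by m ↦ v_T(m) = (R_T(m), C_T(m)); only 1 ≤ m ≤ k matters.
Filling : Set
Filling = ℕ → Box

R : Filling → ℕ → ℕ
R v m = proj₁ (v m)

C : Filling → ℕ → ℕ
C v m = proj₂ (v m)

InRange : ℕ → ℕ → Set
InRange k m = 1 ≤ m × m ≤ k

record IsSYT (λ′ : List ℕ) (k : ℕ) (v : Filling) : Set where
  field
    into     : ∀ m → InRange k m → InDiagram λ′ (v m)
    injective : ∀ m m′ → InRange k m → InRange k m′ → v m ≡ v m′ → m ≡ m′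
    onto     : ∀ b → InDiagram λ′ b → ∃[ m ] (InRange k m × v m ≡ b)
    rowIncr  : ∀ m m′ → InRange k m → InRange k m′ →
               R v m ≡ R v m′ → C v m′ ≡ suc (C v m) → m < m′
    colIncr  : ∀ m m′ → InRange k m → InRange k m′ →
               C v m ≡ C v m′ → R v m′ ≡ suc (R v m) → m < m′

IsSYTh : List ℕ → ℕ → ℕ → ℕ → Filling → Set
IsSYTh λ′ k h α v =
  IsSYT λ′ k v × (∀ i → 1 ≤ i → i < h → R v (i + α) < R v (i + 1 + α))

-- Largest i with 1 ≤ i ≤ n and p i = true (0 if none).
maxIdx : (ℕ → Bool) → ℕ → ℕ
maxIdx p zero = 0
maxIdx p (suc n) = if p (suc n) then suc n else maxIdx p n

qIdx : ℕ → ℕ → Filling → ℕ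
qIdx h α v = maxIdx (λ i → R v (i + α) ≤ᵇ R v α) h

shifted : ℕ → ℕ → Filling → Filling
shifted h α v m =
  if m + 1 ≤ᵇ α
  then v m
  else if ((α ≤ᵇ m) ∧ (m + 2 ≤ᵇ q + α))
       ∨ ((q + α ≤ᵇ m) ∧ (m + 1 ≤ᵇ h + α))
  then v (m + 1)
  else if m + 1 ≡ᵇ q + α
  then v α
  else if m ≡ᵇ h + α
  then v (q + α)
  else v m
  where q = qIdx h α v

-- φ_{λ,h,α}(T); the case distinction "T ∈ SYT_{h,α-1}(λ)" is supplied as a Dec.
φ : (λ′ : List ℕ) (h α : ℕ) (v : Filling) →
    Dec (IsSYTh λ′ (h + α) h (α ∸ 1) v) → Filling
φ λ′ h α v (yes _) = v
φ λ′ h α v (no _)  = shifted h α v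

-- Let q ≥ 1. Then φ(T) is T relabelled first by the cycle (q+α … h+α), which moves the entry
-- q+α to the last position, and then by the cycle (α … q−1+α), which moves α to position q−1+α.
-- Moving an entry a of a standard tableau to a later position b keeps it standard as long as no
-- entry among a+1, …, b lies immediately right of or below a. The entries α+1, …, q−1+α lie in
-- rows strictly above R_T(α), so they cannot neighbour α. The entries y among q+α+1, …, h+α lie
-- in rows strictly below R_T(α) ≥ R_T(q+α), so y can only sit directly under q+α, which forces
-- q+α into the row of α, to the right of α. Then the box under α holds an entry z > α in the row
-- of y; since α+1, …, h+α lie in distinct rows, z = y, contradicting C_T(α) < C_T(q+α).
-- Finally the rows of the entries α, …, h+α−1 of φ(T) are those of T at α+1, …, q−1+α, α,
-- q+1+α, …, h+α, which increase by the choice of q. If q = 0, then R_T(α) < R_T(α+1), so T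
-- already lies in SYT_{h,α−1}(λ).

module Submission where

open import Defs
open import Data.Nat using (ℕ; zero; suc; pred; _+_; _∸_; _≤_; _<_; _≤ᵇ_; _≡ᵇ_; z≤n; s≤s; _≤?_; _<?_; _≟_; >-nonZero)
open import Data.Nat.Properties
open import Data.Bool using (true; false; T)
open import Data.Empty using (⊥-elim)
open import Data.List using (List)
open import Data.Product using (_×_; _,_; proj₁; proj₂; ∃-syntax)
open import Data.Sum using (_⊎_; inj₁; inj₂)
open import Function using (_∘_; case_of_)
open import Relation.Binary.Definitions using (tri<; tri≈; tri>)
open import Relation.Binary.PropositionalEquality
open import Relation.Nullary using (Dec; yes; no; ¬_; contradiction)
open import Relation.Nullary.Decidable using (dec-true; dec-false)

≤ᵇ-true : ∀ {m n} → m ≤ n → (m ≤ᵇ n) ≡ true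
≤ᵇ-true = dec-true (_ ≤? _)

≤ᵇ-false : ∀ {m n} → n < m → (m ≤ᵇ n) ≡ false
≤ᵇ-false n<m = dec-false (_ ≤? _) (<⇒≱ n<m)

≡ᵇ-true : ∀ {m n} → m ≡ n → (m ≡ᵇ n) ≡ true
≡ᵇ-true = dec-true (_ ≟ _)

≡ᵇ-false : ∀ {m n} → m ≢ n → (m ≡ᵇ n) ≡ false
≡ᵇ-false = dec-false (_ ≟ _)

maxIdx-≤ : ∀ p n → maxIdx p n ≤ n
maxIdx-≤ p zero = z≤n
maxIdx-≤ p (suc n) with p (suc n)
... | true  = ≤-refl
... | false = m≤n⇒m≤1+n (maxIdx-≤ p n)

maxIdx-sound : ∀ p n → 1 ≤ maxIdx p n → T (p (maxIdx p n))
maxIdx-sound p (suc n) 1≤max with p (suc n) in eq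
... | true  = subst T (sym eq) _
... | false = maxIdx-sound p n 1≤max

maxIdx-maximal : ∀ p n {i} → maxIdx p n < i → i ≤ n → ¬ T (p i)
maxIdx-maximal p zero () z≤n
maxIdx-maximal p (suc n) max<i i≤1+n with p (suc n) in eq
... | true  = contradiction i≤1+n (<⇒≱ max<i)
... | false with m≤n⇒m<n∨m≡n i≤1+n
...   | inj₁ i<1+n = maxIdx-maximal p n max<i (≤-pred i<1+n)
...   | inj₂ refl  = subst T eq

Adjacent : Box → Box → Set
Adjacent b b′ = (proj₁ b ≡ proj₁ b′ × proj₂ b′ ≡ suc (proj₂ b))
              ⊎ (proj₂ b ≡ proj₂ b′ × proj₁ b′ ≡ suc (proj₁ b))

module _ {λ′ : List ℕ} {n : ℕ} {v : Filling} (S : IsSYT λ′ n v) where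
  open IsSYT S

  adjacent-< : ∀ {x y} → InRange n x → InRange n y → Adjacent (v x) (v y) → x < y
  adjacent-< x∈ y∈ (inj₁ (same , next)) = rowIncr _ _ x∈ y∈ same next
  adjacent-< x∈ y∈ (inj₂ (same , next)) = colIncr _ _ x∈ y∈ same next

  filled-left : ∀ {y j} → InRange n y → 1 ≤ j → j ≤ C v y →
                ∃[ z ] InRange n z × v z ≡ (R v y , j)
  filled-left y∈ 1≤j j≤C with into _ y∈
  ... | 1≤R , R≤ℓ , _ , C≤len = onto _ (1≤R , R≤ℓ , 1≤j , ≤-trans j≤C C≤len)

IsSYT-relabel : ∀ {λ′ n v w} (σ τ : ℕ → ℕ) → IsSYT λ′ n v →
  (∀ m → InRange n m → InRange n (σ m) × τ (σ m) ≡ m) →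
  (∀ x → InRange n x → InRange n (τ x) × σ (τ x) ≡ x) →
  (∀ x y → InRange n x → InRange n y → Adjacent (v x) (v y) → τ x < τ y) →
  (∀ m → InRange n m → w m ≡ v (σ m)) →
  IsSYT λ′ n w
IsSYT-relabel {λ′} {n} {v} {w} σ τ S τ∘σ σ∘τ τ-increasing w≗ = record
  { into      = λ m m∈ → subst (InDiagram λ′) (sym (w≗ m m∈)) (into (σ m) (σ∈ m∈))
  ; injective = λ m m′ m∈ m′∈ wm≡wm′ → begin
      m          ≡⟨ sym (τσ m∈) ⟩
      τ (σ m)    ≡⟨ cong τ (injective _ _ (σ∈ m∈) (σ∈ m′∈)
                      (trans (sym (w≗ m m∈)) (trans wm≡wm′ (w≗ m′ m′∈)))) ⟩
      τ (σ m′)   ≡⟨ τσ m′∈ ⟩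
      m′         ∎
  ; onto      = onto′
  ; rowIncr   = λ m m′ m∈ m′∈ same next → increasing m∈ m′∈ (inj₁ (same , next))
  ; colIncr   = λ m m′ m∈ m′∈ same next → increasing m∈ m′∈ (inj₂ (same , next))
  }
  where
  open IsSYT S
  open ≡-Reasoning

  σ∈ : ∀ {m} → InRange n m → InRange n (σ m)
  σ∈ m∈ = proj₁ (τ∘σ _ m∈)

  τσ : ∀ {m} → InRange n m → τ (σ m) ≡ m
  τσ m∈ = proj₂ (τ∘σ _ m∈)

  increasing : ∀ {m m′} → InRange n m → InRange n m′ → Adjacent (w m) (w m′) → m < m′
  increasing {m} {m′} m∈ m′∈ adj = subst₂ _<_ (τσ m∈) (τσ m′∈)
    (τ-increasing _ _ (σ∈ m∈) (σ∈ m′∈) (subst₂ Adjacent (w≗ m m∈) (w≗ m′ m′∈) adj))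

  onto′ : ∀ b → InDiagram λ′ b → ∃[ m ] InRange n m × w m ≡ b
  onto′ b b∈ with onto b b∈
  ... | x , x∈ , vx≡b with σ∘τ x x∈
  ...   | τx∈ , στx≡x = τ x , τx∈ , trans (w≗ (τ x) τx∈) (trans (cong v στx≡x) vx≡b)

-- The cycle (a a+1 … b): the filling m ↦ v (cycle a b m) puts the entry a of v at position b
-- and moves a+1, …, b one position down.
cycle : ℕ → ℕ → ℕ → ℕ
cycle a b m with m <? a
... | yes _ = m
... | no _ with m <? b
...   | yes _ = suc m
...   | no _ with m ≟ b
...     | yes _ = a
...     | no _  = m

cycle⁻¹ : ℕ → ℕ → ℕ → ℕ
cycle⁻¹ a b x with x <? a
... | yes _ = x
... | no _ with x ≟ a
...   | yes _ = b
...   | no _ with b <? x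
...     | yes _ = x
...     | no _  = pred x

cycle-before : ∀ {a b m} → m < a → cycle a b m ≡ m
cycle-before {a} {b} {m} m<a with m <? a
... | yes _   = refl
... | no m≮a = contradiction m<a m≮a

cycle-inner : ∀ {a b m} → a ≤ m → m < b → cycle a b m ≡ suc m
cycle-inner {a} {b} {m} a≤m m<b with m <? a
... | yes m<a = contradiction a≤m (<⇒≱ m<a)
... | no _ with m <? b
...   | yes _   = refl
...   | no m≮b = contradiction m<b m≮b

cycle-last : ∀ {a b} → a ≤ b → cycle a b b ≡ a
cycle-last {a} {b} a≤b with b <? a
... | yes b<a = contradiction a≤b (<⇒≱ b<a)
... | no _ with b <? b
...   | yes b<b = contradiction b<b (<-irrefl refl)
...   | no _ with b ≟ b
...     | yes _   = refl
...     | no b≢b = contradiction refl b≢b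

cycle-after : ∀ {a b m} → b < m → cycle a b m ≡ m
cycle-after {a} {b} {m} b<m with m <? a
... | yes _ = refl
... | no _ with m <? b
...   | yes m<b = contradiction m<b (<-asym b<m)
...   | no _ with m ≟ b
...     | yes m≡b = contradiction b<m (<-irrefl (sym m≡b))
...     | no _    = refl

cycle⁻¹-before : ∀ {a b x} → x < a → cycle⁻¹ a b x ≡ x
cycle⁻¹-before {a} {b} {x} x<a with x <? a
... | yes _   = refl
... | no x≮a = contradiction x<a x≮a

cycle⁻¹-first : ∀ {a b} → cycle⁻¹ a b a ≡ b
cycle⁻¹-first {a} {b} with a <? a
... | yes a<a = contradiction a<a (<-irrefl refl)
... | no _ with a ≟ a
...   | yes _   = refl
...   | no a≢a = contradiction refl a≢a

cycle⁻¹-inner : ∀ {a b x} → a < x → x ≤ b → cycle⁻¹ a b x ≡ pred x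
cycle⁻¹-inner {a} {b} {x} a<x x≤b with x <? a
... | yes x<a = contradiction x<a (<-asym a<x)
... | no _ with x ≟ a
...   | yes x≡a = contradiction a<x (<-irrefl (sym x≡a))
...   | no _ with b <? x
...     | yes b<x = contradiction x≤b (<⇒≱ b<x)
...     | no _    = refl

cycle⁻¹-after : ∀ {a b x} → a ≤ b → b < x → cycle⁻¹ a b x ≡ x
cycle⁻¹-after {a} {b} {x} a≤b b<x with x <? a
... | yes _ = refl
... | no _ with x ≟ a
...   | yes x≡a = contradiction (≤-<-trans a≤b b<x) (<-irrefl (sym x≡a))
...   | no _ with b <? x
...     | yes _   = refl
...     | no b≮x = contradiction b<x b≮x

module _ {a b : ℕ} (a≤b : a ≤ b) where

  cycle⁻¹-≤ : ∀ {x} → x ≢ a → cycle⁻¹ a b x ≤ x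
  cycle⁻¹-≤ {x} x≢a with <-cmp x a
  ... | tri< x<a _ _ = ≤-reflexive (cycle⁻¹-before x<a)
  ... | tri≈ _ x≡a _ = contradiction x≡a x≢a
  ... | tri> _ _ a<x with x ≤? b
  ...   | yes x≤b = ≤-trans (≤-reflexive (cycle⁻¹-inner a<x x≤b)) pred[n]≤n
  ...   | no x≰b  = ≤-reflexive (cycle⁻¹-after a≤b (≰⇒> x≰b))

  cycle⁻¹-increasing : ∀ {x y} → x < y → x ≢ a → y ≢ a → cycle⁻¹ a b x < cycle⁻¹ a b y
  cycle⁻¹-increasing {x} {y} x<y x≢a y≢a with <-cmp y a
  ... | tri< y<a _ _ rewrite cycle⁻¹-before {b = b} y<a | cycle⁻¹-before {b = b} (<-trans x<y y<a) = x<y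
  ... | tri≈ _ y≡a _ = contradiction y≡a y≢a
  ... | tri> _ _ a<y with y ≤? b
  ...   | no y≰b rewrite cycle⁻¹-after a≤b (≰⇒> y≰b) = ≤-<-trans (cycle⁻¹-≤ x≢a) x<y
  ...   | yes y≤b rewrite cycle⁻¹-inner a<y y≤b with <-cmp x a
  ...     | tri< x<a _ _ rewrite cycle⁻¹-before {b = b} x<a = <-≤-trans x<a (<⇒≤pred a<y)
  ...     | tri≈ _ x≡a _ = contradiction x≡a x≢a
  ...     | tri> _ _ a<x rewrite cycle⁻¹-inner a<x (≤-trans (<⇒≤ x<y) y≤b) =
              pred-mono-< {{>-nonZero (≤-<-trans z≤n a<x)}} x<y

module _ {a b n : ℕ} (1≤a : 1 ≤ a) (a≤b : a ≤ b) (b≤n : b ≤ n) where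

  cycle-inverseˡ : ∀ {m} → InRange n m → InRange n (cycle a b m) × cycle⁻¹ a b (cycle a b m) ≡ m
  cycle-inverseˡ {m} m∈ with a ≤? m | <-cmp m b
  ... | no m≱a | _ rewrite cycle-before {b = b} (≰⇒> m≱a) = m∈ , cycle⁻¹-before (≰⇒> m≱a)
  ... | yes a≤m | tri< m<b _ _ rewrite cycle-inner a≤m m<b =
          (s≤s z≤n , ≤-trans m<b b≤n) , cycle⁻¹-inner (s≤s a≤m) m<b
  ... | yes _ | tri≈ _ m≡b _ rewrite m≡b | cycle-last a≤b = (1≤a , ≤-trans a≤b b≤n) , cycle⁻¹-first {a}
  ... | yes _ | tri> _ _ b<m rewrite cycle-after {a} b<m = m∈ , cycle⁻¹-after a≤b b<m

  cycle-inverseʳ : ∀ {x} → InRange n x → InRange n (cycle⁻¹ a b x) × cycle a b (cycle⁻¹ a b x) ≡ x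
  cycle-inverseʳ {zero} (() , _)
  cycle-inverseʳ {suc x} x∈ with <-cmp (suc x) a
  ... | tri< x<a _ _ rewrite cycle⁻¹-before {b = b} x<a = x∈ , cycle-before x<a
  ... | tri≈ _ x≡a _ rewrite x≡a | cycle⁻¹-first {a} {b} = (≤-trans 1≤a a≤b , b≤n) , cycle-last a≤b
  ... | tri> _ _ a<x with suc x ≤? b
  ...   | no x≰b rewrite cycle⁻¹-after a≤b (≰⇒> x≰b) = x∈ , cycle-after {a} (≰⇒> x≰b)
  ...   | yes x≤b rewrite cycle⁻¹-inner a<x x≤b =
            (≤-trans 1≤a (≤-pred a<x) , ≤-trans (n≤1+n x) (proj₂ x∈)) , cycle-inner (≤-pred a<x) x≤b

IsSYT-cycle : ∀ {λ′ n v w a b} → IsSYT λ′ n v → 1 ≤ a → a ≤ b → b ≤ n →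
  (∀ y → a < y → y ≤ b → ¬ Adjacent (v a) (v y)) →
  (∀ m → InRange n m → w m ≡ v (cycle a b m)) →
  IsSYT λ′ n w
IsSYT-cycle {n = n} {v} {a = a} {b} S 1≤a a≤b b≤n a-isolated =
  IsSYT-relabel (cycle a b) (cycle⁻¹ a b) S
    (λ _ → cycle-inverseˡ 1≤a a≤b b≤n) (λ _ → cycle-inverseʳ 1≤a a≤b b≤n) increasing
  where
  increasing : ∀ x y → InRange n x → InRange n y → Adjacent (v x) (v y) →
               cycle⁻¹ a b x < cycle⁻¹ a b y
  increasing x y x∈ y∈ adj with adjacent-< S x∈ y∈ adj | x ≟ a | y ≟ a
  ... | x<y | yes refl | _ = subst₂ _<_ (sym (cycle⁻¹-first {a})) (sym (cycle⁻¹-after a≤b b<y)) b<y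
    where
    b<y : b < y
    b<y = ≰⇒> (λ y≤b → a-isolated y x<y y≤b adj)
  ... | x<y | no _ | yes refl =
          subst₂ _<_ (sym (cycle⁻¹-before {b = b} x<y)) (sym (cycle⁻¹-first {a})) (<-≤-trans x<y a≤b)
  ... | x<y | no x≢a | no y≢a = cycle⁻¹-increasing a≤b x<y x≢a y≢a

-- T ∈ SYT_{h,α}(λ) asks for RowsAscend T (α + 1) (α + h), see chain⇒RowsAscend.
record RowsAscend (v : Filling) (s t : ℕ) : Set where
  constructor rowsAscend
  field
    step : ∀ p → s ≤ p → suc p ≤ t → R v p < R v (suc p)

open RowsAscend

module _ {v : Filling} {s t : ℕ} (asc : RowsAscend v s t) where

  RowsAscend-< : ∀ {x y} → s ≤ x → x < y → y ≤ t → R v x < R v y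
  RowsAscend-< {x} {suc y} s≤x (s≤s x≤y) y<t with m≤n⇒m<n∨m≡n x≤y
  ... | inj₁ x<y = <-trans (RowsAscend-< s≤x x<y (<⇒≤ y<t)) (step asc y (≤-trans s≤x x≤y) y<t)
  ... | inj₂ refl = step asc x s≤x y<t

  RowsAscend-injective : ∀ {x y} → s ≤ x → s ≤ y → x ≤ t → y ≤ t → R v x ≡ R v y → x ≡ y
  RowsAscend-injective s≤x s≤y x≤t y≤t same with <-cmp _ _
  ... | tri< x<y _ _ = contradiction same (<⇒≢ (RowsAscend-< s≤x x<y y≤t))
  ... | tri≈ _ x≡y _ = x≡y
  ... | tri> _ _ y<x = contradiction (sym same) (<⇒≢ (RowsAscend-< s≤y y<x x≤t))

RowsAscend-cons : ∀ {v s t} → R v s < R v (suc s) → RowsAscend v (suc s) t → RowsAscend v s t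
RowsAscend-cons first asc = rowsAscend λ p s≤p p<t → case m≤n⇒m<n∨m≡n s≤p of λ where
  (inj₁ s<p)  → step asc p s<p p<t
  (inj₂ refl) → first

RowsAscend-shrink : ∀ {v s t t′} → t′ ≤ t → RowsAscend v s t → RowsAscend v s t′
RowsAscend-shrink t′≤t asc = rowsAscend λ p s≤p p<t′ → step asc p s≤p (≤-trans p<t′ t′≤t)

RowsAscend⇒chain : ∀ {v h c} → RowsAscend v (suc c) (h + c) →
                   ∀ i → 1 ≤ i → i < h → R v (i + c) < R v (i + 1 + c)
RowsAscend⇒chain {v} {h} {c} asc i 1≤i i<h =
  subst (λ j → R v (i + c) < R v (j + c)) (+-comm 1 i)
    (step asc (i + c) (+-monoˡ-≤ c 1≤i) (+-monoˡ-≤ c i<h))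

chain⇒RowsAscend : ∀ {v h c} → (∀ i → 1 ≤ i → i < h → R v (i + c) < R v (i + 1 + c)) →
                   RowsAscend v (suc c) (h + c)
chain⇒RowsAscend {v} {h} {c} chain = rowsAscend rise
  where
  rise : ∀ p → suc c ≤ p → suc p ≤ h + c → R v p < R v (suc p)
  rise p c<p p<h+c =
    subst₂ (λ x y → R v x < R v y) i+c≡p (trans (cong (_+ c) (+-comm i 1)) (cong suc i+c≡p))
      (chain i (m<n⇒0<n∸m c<p) (+-cancelʳ-≤ c (suc i) h (subst (_≤ h + c) (sym (cong suc i+c≡p)) p<h+c)))
    where
    i : ℕ
    i = p ∸ c
    i+c≡p : i + c ≡ p
    i+c≡p = m∸n+n≡m (<⇒≤ c<p)

module Shifted {λ′ : List ℕ} {h a : ℕ} {v : Filling} (S : IsSYT λ′ (h + suc a) v)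
             (asc : RowsAscend v (suc (suc a)) (h + suc a))
             (k : ℕ) (q≡ : qIdx h (suc a) v ≡ suc k) where

  open IsSYT S

  α : ℕ
  α = suc a

  n : ℕ
  n = h + α

  q : ℕ
  q = suc k

  α≤n : α ≤ n
  α≤n = m≤n+m α h

  α<qα : α < q + α
  α<qα = s≤s (m≤n+m α k)

  q≤h : q ≤ h
  q≤h = subst (_≤ h) q≡ (maxIdx-≤ _ h)

  qα≤n : q + α ≤ n
  qα≤n = +-monoˡ-≤ α q≤h

  kα≤n : k + α ≤ n
  kα≤n = ≤-trans (n≤1+n (k + α)) qα≤n

  h+a<n : h + a < n
  h+a<n = +-monoʳ-< h (n<1+n a)

  α∈ : InRange n α
  α∈ = s≤s z≤n , α≤n

  qα∈ : InRange n (q + α)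
  qα∈ = s≤s z≤n , qα≤n

  row-q : R v (q + α) ≤ R v α
  row-q = ≤ᵇ⇒≤ _ _ (subst (λ i → T (R v (i + α) ≤ᵇ R v α)) q≡
                      (maxIdx-sound _ h (subst (1 ≤_) (sym q≡) (s≤s z≤n))))

  below-q : ∀ {y} → α < y → y < q + α → R v y < R v α
  below-q α<y y<qα = <-≤-trans (RowsAscend-< asc α<y y<qα qα≤n) row-q

  above-q : ∀ {y} → q + α < y → y ≤ n → R v α < R v y
  above-q {y} qα<y y≤n =
    subst (λ z → R v α < R v z) (m∸n+n≡m α≤y) (≰⇒> (not-below ∘ ≤⇒≤ᵇ))
    where
    α≤y : α ≤ y
    α≤y = ≤-trans (m≤n+m α q) (<⇒≤ qα<y)
    q<i : q < y ∸ α
    q<i = subst (_< y ∸ α) (m+n∸n≡m q α) (∸-monoˡ-< qα<y (m≤n+m α q))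
    i≤h : y ∸ α ≤ h
    i≤h = subst (y ∸ α ≤_) (m+n∸n≡m h α) (∸-monoˡ-≤ α y≤n)
    not-below : ¬ T (R v (y ∸ α + α) ≤ᵇ R v α)
    not-below = maxIdx-maximal _ h (subst (_< y ∸ α) (sym q≡) q<i) i≤h

  α-isolated : ∀ y → α < y → y < q + α → ¬ Adjacent (v α) (v y)
  α-isolated y α<y y<qα (inj₁ (same , _)) = <-irrefl (sym same) (below-q α<y y<qα)
  α-isolated y α<y y<qα (inj₂ (_ , down)) =
    <-asym (below-q α<y y<qα) (subst (R v α <_) (sym down) (n<1+n _))

  α-left-of-qα : R v (q + α) ≡ R v α → C v α < C v (q + α)
  α-left-of-qα same with <-cmp (C v α) (C v (q + α))
  ... | tri< α-left _ _ = α-left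
  ... | tri≈ _ sameCol _ =
          contradiction (injective _ _ α∈ qα∈ (cong₂ _,_ (sym same) sameCol)) (<⇒≢ α<qα)
  ... | tri> _ _ qα-left with filled-left S α∈ (s≤s z≤n) qα-left
  ...   | z , z∈ , vz =
            ⊥-elim (<-irrefl (sym (cong proj₁ vz)) (above-q qα<z (proj₂ z∈)))
    where
    qα<z : q + α < z
    qα<z = rowIncr _ _ qα∈ z∈ (trans same (sym (cong proj₁ vz))) (cong proj₂ vz)

  qα-isolated : ∀ y → q + α < y → y ≤ n → ¬ Adjacent (v (q + α)) (v y)
  qα-isolated y qα<y y≤n (inj₁ (same , _)) =
    <⇒≱ (above-q qα<y y≤n) (subst (_≤ R v α) same row-q)
  qα-isolated y qα<y y≤n (inj₂ (sameCol , down)) = <-irrefl Cα≡Cqα α-left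
    where
    same : R v (q + α) ≡ R v α
    same = ≤-antisym row-q (≤-pred (subst (R v α <_) down (above-q qα<y y≤n)))
    α-left : C v α < C v (q + α)
    α-left = α-left-of-qα same
    α<y : α < y
    α<y = <-trans α<qα qα<y
    under-α : ∃[ z ] InRange n z × v z ≡ (R v y , C v α)
    under-α = filled-left S (≤-trans (s≤s z≤n) α<y , y≤n) (proj₁ (proj₂ (proj₂ (into α α∈))))
                (subst (C v α ≤_) sameCol (<⇒≤ α-left))
    z : ℕ
    z = proj₁ under-α
    vz : v z ≡ (R v y , C v α)
    vz = proj₂ (proj₂ under-α)
    α<z : α < z
    α<z = colIncr _ _ α∈ (proj₁ (proj₂ under-α)) (cong proj₂ (sym vz))
            (trans (cong proj₁ vz) (trans down (cong suc same)))
    z≡y : z ≡ y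
    z≡y = RowsAscend-injective asc α<z α<y (proj₂ (proj₁ (proj₂ under-α))) y≤n
            (cong proj₁ vz)
    Cα≡Cqα : C v α ≡ C v (q + α)
    Cα≡Cqα = trans (cong proj₂ (sym vz)) (trans (cong (C v) z≡y) (sym sameCol))

  T₁ : Filling
  T₁ m = v (cycle (q + α) n m)

  T₁-SYT : IsSYT λ′ n T₁
  T₁-SYT = IsSYT-cycle S (s≤s z≤n) qα≤n ≤-refl qα-isolated (λ _ _ → refl)

  shifted-below : ∀ {m} → m < α → shifted h α v m ≡ v m
  shifted-below {m} m<α rewrite q≡ | +-comm m 1 | ≤ᵇ-true m<α = refl

  shifted-lower : ∀ {m} → α ≤ m → m < k + α → shifted h α v m ≡ v (suc m)
  shifted-lower {m} α≤m m<kα rewrite q≡ | +-comm m 1 | +-comm m 2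
    | ≤ᵇ-false {suc m} (s≤s α≤m) | ≤ᵇ-true α≤m | ≤ᵇ-true {suc (suc m)} (s≤s m<kα) = refl

  shifted-drop : shifted h α v (k + α) ≡ v α
  shifted-drop rewrite q≡ | +-comm (k + α) 1 | +-comm (k + α) 2
    | ≤ᵇ-false {suc (k + α)} (s≤s (m≤n+m α k)) | ≤ᵇ-true (m≤n+m α k)
    | ≤ᵇ-false {suc (suc (k + α))} {q + α} ≤-refl
    | ≡ᵇ-true {suc (k + α)} {q + α} refl = refl

  shifted-upper : ∀ {m} → q + α ≤ m → m < n → shifted h α v m ≡ v (suc m)
  shifted-upper {m} qα≤m m<n rewrite q≡ | +-comm m 1 | +-comm m 2
    | ≤ᵇ-false {suc m} {α} (s≤s (≤-trans (m≤n+m α q) qα≤m)) | ≤ᵇ-true (≤-trans (m≤n+m α q) qα≤m)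
    | ≤ᵇ-false {suc (suc m)} {q + α} (s≤s (m≤n⇒m≤1+n qα≤m)) | ≤ᵇ-true qα≤m
    | ≤ᵇ-true {suc m} {h + α} m<n = refl

  shifted-top : shifted h α v n ≡ v (q + α)
  shifted-top rewrite q≡ | +-comm n 1 | +-comm n 2
    | ≤ᵇ-false {suc n} {α} (s≤s α≤n) | ≤ᵇ-true α≤n
    | ≤ᵇ-false {suc (suc n)} {q + α} (s≤s (m≤n⇒m≤1+n qα≤n))
    | ≤ᵇ-true qα≤n | ≤ᵇ-false {suc n} {n} ≤-refl
    | ≡ᵇ-false {suc n} {q + α} (λ e → <-irrefl (sym e) (s≤s qα≤n)) | ≡ᵇ-true {n} {n} refl = refl

  shifted≗ : ∀ m → InRange n m → shifted h α v m ≡ T₁ (cycle α (k + α) m)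
  shifted≗ m (_ , m≤n) with <-cmp m (k + α)
  ... | tri< m<kα _ _ with α ≤? m
  ...   | no m≱α rewrite cycle-before {b = k + α} (≰⇒> m≱α)
                       | cycle-before {b = n} (<-trans (≰⇒> m≱α) α<qα) = shifted-below (≰⇒> m≱α)
  ...   | yes α≤m rewrite cycle-inner α≤m m<kα | cycle-before {b = n} (s≤s m<kα) = shifted-lower α≤m m<kα
  shifted≗ m (_ , m≤n) | tri≈ _ refl _
    rewrite cycle-last (m≤n+m α k) | cycle-before {b = n} α<qα = shifted-drop
  shifted≗ m (_ , m≤n) | tri> _ _ kα<m with m≤n⇒m<n∨m≡n m≤n
  ...   | inj₁ m<n rewrite cycle-after {α} kα<m | cycle-inner kα<m m<n = shifted-upper kα<m m<n
  ...   | inj₂ refl rewrite cycle-after {α} kα<m | cycle-last qα≤n = shifted-top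

  shifted-SYT : IsSYT λ′ n (shifted h α v)
  shifted-SYT = IsSYT-cycle T₁-SYT (s≤s z≤n) (m≤n+m α k) kα≤n isolated shifted≗
    where
    isolated : ∀ y → α < y → y ≤ k + α → ¬ Adjacent (T₁ α) (T₁ y)
    isolated y α<y y≤kα rewrite cycle-before {b = n} α<qα | cycle-before {b = n} (s≤s y≤kα) =
      α-isolated y α<y (s≤s y≤kα)

  rise-via : ∀ p {x y} → shifted h α v p ≡ v x → shifted h α v (suc p) ≡ v y →
         R v x < R v y → R (shifted h α v) p < R (shifted h α v) (suc p)
  rise-via _ e e′ = subst₂ _<_ (cong proj₁ (sym e)) (cong proj₁ (sym e′))

  shifted-rise : ∀ p → α ≤ p → suc p ≤ h + a → R (shifted h α v) p < R (shifted h α v) (suc p)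
  shifted-rise p α≤p p<h+a with <-cmp p (k + α)
  ... | tri< p<kα _ _ with m≤n⇒m<n∨m≡n p<kα
  ...   | inj₁ 1+p<kα = rise-via p (shifted-lower α≤p p<kα) (shifted-lower (m≤n⇒m≤1+n α≤p) 1+p<kα)
                             (step asc (suc p) (s≤s α≤p) (≤-trans 1+p<kα kα≤n))
  ...   | inj₂ 1+p≡kα = rise-via p (shifted-lower α≤p p<kα) (trans (cong (shifted h α v) 1+p≡kα) shifted-drop)
                             (below-q (s≤s α≤p) (s≤s (≤-reflexive 1+p≡kα)))
  shifted-rise p α≤p p<h+a | tri≈ _ refl _ =
    rise-via p shifted-drop (shifted-upper ≤-refl qα<n) (above-q (n<1+n _) qα<n)
    where
    qα<n : q + α < n
    qα<n = ≤-<-trans p<h+a h+a<n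
  shifted-rise p α≤p p<h+a | tri> _ _ kα<p =
    rise-via p (shifted-upper kα<p p<n) (shifted-upper (m≤n⇒m≤1+n kα<p) 1+p<n)
         (step asc (suc p) (s≤s α≤p) 1+p<n)
    where
    1+p<n : suc p < n
    1+p<n = ≤-<-trans p<h+a h+a<n
    p<n : p < n
    p<n = <-trans (n<1+n p) 1+p<n

  shifted-rows : RowsAscend (shifted h α v) α (h + a)
  shifted-rows = rowsAscend shifted-rise

  shifted-SYTh : IsSYTh λ′ n h a (shifted h α v)
  shifted-SYTh = shifted-SYT , RowsAscend⇒chain shifted-rows

qIdx≡0⇒step : ∀ {h α v} → 1 ≤ h → qIdx h α v ≡ 0 → R v α < R v (suc α)
qIdx≡0⇒step {h} {α} {v} 1≤h q≡0 =
  ≰⇒> (maxIdx-maximal (λ i → R v (i + α) ≤ᵇ R v α) h (subst (_< 1) (sym q≡0) (s≤s z≤n)) 1≤h ∘ ≤⇒≤ᵇ)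

proposition4p3 : (h α : ℕ) → 1 ≤ h → 1 ≤ α → (λ′ : List ℕ) → IsPartition λ′ (h + α) →
    (v : Filling) → IsSYTh λ′ (h + α) h α v →
    (d : Dec (IsSYTh λ′ (h + α) h (α ∸ 1) v)) →
    IsSYTh λ′ (h + α) h (α ∸ 1) (φ λ′ h α v d)
-- The argument never uses that λ′ is a partition.
proposition4p3 h α _ _ λ′ _ v _ (yes T∈SYTh) = T∈SYTh
proposition4p3 h zero _ () λ′ _ v _ (no _)
proposition4p3 h (suc a) 1≤h _ λ′ _ v (S , chain) (no T∉SYTh) = case-q (qIdx h (suc a) v) refl
  where
  asc : RowsAscend v (suc (suc a)) (h + suc a)
  asc = chain⇒RowsAscend chain

  case-q : ∀ q → qIdx h (suc a) v ≡ q → IsSYTh λ′ (h + suc a) h a (shifted h (suc a) v)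
  case-q zero    q≡0 = ⊥-elim (T∉SYTh (S , RowsAscend⇒chain
                         (RowsAscend-cons (qIdx≡0⇒step {v = v} 1≤h q≡0)
                           (RowsAscend-shrink (+-monoʳ-≤ h (n≤1+n a)) asc))))
  case-q (suc k) q≡ = Shifted.shifted-SYTh S asc k q≡
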